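{- Let $d\geq 1$, $i\geq 0$, $I=[i,i+d-1]$ and $J=\{j_1,\ldots,j_d\}$ with $0\leq j_1<\cdots<j_d$, and suppose $J\leq I$. Then for every $1\leq k\leq d-1$, \[ b^I_J=\Big(\prod_{\ell=0}^{k-1}\pi^{I^{(\ell)}}_{J^{(\ell)}}\Big)\, b^{I^{(k)}}_{J^{(k)}}, \] and moreover \[ b^I_J=\prod_{\ell=0}^{d-1}\pi^{I^{(\ell)}}_{J^{(\ell)}}. \]
   Context: For integers $p,q\geq 0$, $b_{p,q}=\binom{p}{q}$, with $b_{p,q}=0$ if $q>p$. For $k\leq l$, $[k,l]=\{k,\ldots,l\}$. For finite sets $I=\{i_1<\cdots<i_m\}$, $J=\{j_1<\cdots<j_m\}$ of non-negative integers, $b^I_J$ is the determinant of the $m\times m$ matrix with $(r,s)$ entry $b_{i_r,j_s}$; $J\leq I$ means $j_k\leq i_k$ for all $k$; and when $J\leq I$, $\pi^I_J=\frac{b_{i_1,j_1}\cdots b_{i_m,j_1}}{b_{j_1,j_1}\cdots b_{j_m,j_1}}$. For a set $S$ of integers and an integer $p$, $S-p=\{s-p: s\in S\}$. With $I=[i,i+d-1]$ and $J=\{j_1<\cdots<j_d\}\leq I$, set $I^{(0)}=I$, $J^{(0)}=J$, and for $1\leq k\leq d-1$: $I^{(k)}=[i+k-1,\,i+d-2]-j_k$ and $J^{(k)}=\{j_{k+1},\ldots,j_d\}-j_k-1$ (both of cardinality $d-k$). -}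

module Defs where

open import Data.Nat using (ℕ; zero; suc; _+_; _∸_)
open import Data.Nat.Combinatorics using (_C_)
open import Data.Integer as ℤ using (ℤ; +_)
open import Data.List using (List; []; _∷_; map; foldr; drop; upTo; length)
open import Data.Product using (_×_; _,_)
open import Data.Rational as ℚ using (ℚ; 1ℚ; 0ℚ)

-- b_{p,q} = binom(p,q), which is 0 when q > p (stdlib's _C_ has this convention)
b : ℕ → ℕ → ℕ
b p q = p C q

picks : {A : Set} → List A → List (A × List A)
picks [] = []
picks (x ∷ xs) = (x , xs) ∷ map (λ { (y , ys) → (y , x ∷ ys) }) (picks xs)

altSum : List ℤ → ℤ
altSum [] = + 0
altSum (x ∷ xs) = x ℤ.- altSum xs

-- b^I_J : determinant of the matrix (b_{i_r, j_s})_{r,s}, rows indexed by the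
-- list I, columns by the list J, computed by Laplace expansion along the first row.
-- (Used only with |I| = |J|; the empty determinant is 1.)
bdet : List ℕ → List ℕ → ℤ
bdet [] _ = + 1
bdet (r ∷ rs) cs = altSum (map (λ { (c , rest) → (+ b r c) ℤ.* bdet rs rest }) (picks cs))

interval : ℕ → ℕ → List ℕ
interval a zero = []
interval a (suc n) = a ∷ interval (suc a) n

hd : List ℕ → ℕ
hd [] = 0
hd (x ∷ _) = x

nth : List ℕ → ℕ → ℕ
nth [] _ = 0
nth (x ∷ _) zero = x
nth (_ ∷ xs) (suc k) = nth xs k

-- natural-number fraction n / m as a rational (0 if m = 0; never used with m = 0
-- in the theorem, since there m is a product of binomials b_{j_s,j_1} with j_s ≥ j_1)
frac : ℕ → ℕ → ℚ
frac n zero = 0ℚ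
frac n (suc m) = (+ n) ℚ./ suc m

prodℕ : List ℕ → ℕ
prodℕ = foldr Data.Nat._*_ 1
  where import Data.Nat

prodℚ : List ℚ → ℚ
prodℚ = foldr ℚ._*_ 1ℚ

piIJ : List ℕ → List ℕ → ℚ
piIJ I J = frac (prodℕ (map (λ x → b x j₁) I)) (prodℕ (map (λ y → b y j₁) J))
  where j₁ = hd J

-- I^{(ℓ)} for I = [i, i+d-1] and J = js (a list j_1 < ... < j_d):
--   I^{(0)} = I,   I^{(k)} = [i+k-1, i+d-2] - j_k  for k ≥ 1
-- (note j_k = nth js (k-1), and [i+k-1, i+d-2] has d-k elements)
Iₗ : ℕ → ℕ → List ℕ → ℕ → List ℕ
Iₗ i d js zero = interval i d
Iₗ i d js (suc m) = map (λ t → t ∸ nth js m) (interval (i + m) (d ∸ suc m))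

Jₗ : List ℕ → ℕ → List ℕ
Jₗ js zero = js
Jₗ js (suc m) = map (λ t → t ∸ nth js m ∸ 1) (drop (suc m) js)

prodπ : ℕ → ℕ → List ℕ → ℕ → ℚ
prodπ i d js k = prodℚ (map (λ ℓ → piIJ (Iₗ i d js ℓ) (Jₗ js ℓ)) (upTo k))

toℚ : ℤ → ℚ
toℚ z = z ℚ./ 1

module Submission where

-- Write C(p, q) for b_{p,q}. Since C(r, j+c) C(j+c, j) = C(r, j) C(r-j, c), multiplying column y of
-- (C(r, y)) by C(y, j₁) and dividing row r by C(r, j₁) produces the matrix (C(r-j₁, y-j₁)); the
-- ratio of the two products is π^I_J. The rows r - j₁ of the new matrix are consecutive and its first
-- column consists of ones, so subtracting from each row but the first its predecessor (Pascal:
-- C(t+1, c) - C(t, c) = C(t, c-1)) leaves the first column (1, 0, ..., 0); deleting it leaves the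
-- binomial matrix on the rows I^{(1)} and the columns J^{(1)}. Peeling (I^{(1)}, J^{(1)}) once more
-- produces (I^{(2)}, J^{(2)}), and so on, which gives the formula for every k ≤ d; for k = d the
-- remaining determinant is empty.
--
-- Expanding along two rows in either order
-- gives opposite results, so two equal rows give 0, and this is what justifies the row operations.

module Binomial where

  open import Data.Empty using (⊥-elim)
  open import Data.Nat
  open import Data.Nat.Properties
  open import Data.Nat.Combinatorics using (_C_; nCk≡n!/k![n-k]!; k>n⇒nCk≡0; k![n∸k]!∣n!)
  open import Data.Nat.DivMod using (m/n*n≡m)
  open import Data.Nat.Tactic.RingSolver using (solve-∀)
  open import Data.Product using (_,_)
  open import Relation.Binary.PropositionalEquality
  open import Relation.Nullary using (yes; no)

  [k+l]Ck*k!*l!≡[k+l]! : ∀ k l → ((k + l) C k) * (k ! * l !) ≡ (k + l) !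
  [k+l]Ck*k!*l!≡[k+l]! k l = begin
    ((k + l) C k) * (k ! * l !)
      ≡⟨ cong (λ z → ((k + l) C k) * (k ! * z !)) (m+n∸m≡n k l) ⟨
    ((k + l) C k) * (k ! * (k + l ∸ k) !)
      ≡⟨ cong (_* (k ! * (k + l ∸ k) !)) (nCk≡n!/k![n-k]! k≤k+l) ⟩
    ((k + l) ! / (k ! * (k + l ∸ k) !)) {{k!*[k+l∸k]!≢0}} * (k ! * (k + l ∸ k) !)
      ≡⟨ m/n*n≡m {{k!*[k+l∸k]!≢0}} (k![n∸k]!∣n! k≤k+l) ⟩
    (k + l) ! ∎
    where
    open ≡-Reasoning
    k≤k+l = m≤m+n k l
    k!*[k+l∸k]!≢0 = _!*_!≢0 k (k + l ∸ k)

  0<[k+l]Ck : ∀ k l → 0 < (k + l) C k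
  0<[k+l]Ck k l with (k + l) C k | [k+l]Ck*k!*l!≡[k+l]! k l
  ... | zero  | 0≡[k+l]! = ⊥-elim (<-irrefl 0≡[k+l]! (1≤n! (k + l)))
  ... | suc _ | _        = z<s

  0<nCk : ∀ {n k} → k ≤ n → 0 < n C k
  0<nCk {n} {k} k≤n with m≤n⇒∃[o]m+o≡n k≤n
  ... | l , refl = 0<[k+l]Ck k l

  -- Both sides, multiplied by k! m! e!, equal (k + m + e)!.
  [k+m+e]C[k+m]*[k+m]Ck≡[k+m+e]Ck*[m+e]Cm : ∀ k m e →
    ((k + m + e) C (k + m)) * ((k + m) C k) ≡ ((k + (m + e)) C k) * ((m + e) C m)
  [k+m+e]C[k+m]*[k+m]Ck≡[k+m+e]Ck*[m+e]Cm k m e =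
    *-cancelʳ-≡ _ _ (k ! * m ! * e !) {{m*n≢0 (k ! * m !) (e !) {{_!*_!≢0 k m}} {{e !≢0}}}} (begin
      X * Y * (k ! * m ! * e !)     ≡⟨ regroupˡ X Y (k !) (m !) (e !) ⟩
      X * (Y * (k ! * m !) * e !)   ≡⟨ cong (λ z → X * (z * e !)) ([k+l]Ck*k!*l!≡[k+l]! k m) ⟩
      X * ((k + m) ! * e !)         ≡⟨ [k+l]Ck*k!*l!≡[k+l]! (k + m) e ⟩
      (k + m + e) !                 ≡⟨ cong _! (+-assoc k m e) ⟩
      (k + (m + e)) !               ≡⟨ [k+l]Ck*k!*l!≡[k+l]! k (m + e) ⟨
      U * (k ! * (m + e) !)         ≡⟨ cong (λ z → U * (k ! * z)) ([k+l]Ck*k!*l!≡[k+l]! m e) ⟨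
      U * (k ! * (V * (m ! * e !))) ≡⟨ regroupʳ U V (k !) (m !) (e !) ⟩
      U * V * (k ! * m ! * e !)     ∎)
    where
    open ≡-Reasoning
    X = (k + m + e) C (k + m)
    Y = (k + m) C k
    U = (k + (m + e)) C k
    V = (m + e) C m
    regroupˡ : ∀ x y a b c → x * y * (a * b * c) ≡ x * (y * (a * b) * c)
    regroupˡ = solve-∀
    regroupʳ : ∀ u v a b c → u * (a * (v * (b * c))) ≡ u * v * (a * b * c)
    regroupʳ = solve-∀

  nC[k+m]*[k+m]Ck≡nCk*[n∸k]Cm : ∀ n k m → (n C (k + m)) * ((k + m) C k) ≡ (n C k) * ((n ∸ k) C m)
  nC[k+m]*[k+m]Ck≡nCk*[n∸k]Cm n k m with k + m ≤? n
  ... | yes k+m≤n with m≤n⇒∃[o]m+o≡n k+m≤n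
  ...   | e , refl = trans ([k+m+e]C[k+m]*[k+m]Ck≡[k+m+e]Ck*[m+e]Cm k m e)
                       (cong₂ (λ p q → (p C k) * (q C m)) (sym (+-assoc k m e)) (sym n∸k≡m+e))
    where
    n∸k≡m+e : k + m + e ∸ k ≡ m + e
    n∸k≡m+e = trans (cong (_∸ k) (+-assoc k m e)) (m+n∸m≡n k (m + e))
  nC[k+m]*[k+m]Ck≡nCk*[n∸k]Cm n k m | no k+m≰n with k ≤? n
  ... | no k≰n  = begin
    (n C (k + m)) * ((k + m) C k)  ≡⟨ cong (_* ((k + m) C k)) (k>n⇒nCk≡0 (≰⇒> k+m≰n)) ⟩
    0                              ≡⟨ cong (_* ((n ∸ k) C m)) (k>n⇒nCk≡0 (≰⇒> k≰n)) ⟨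
    (n C k) * ((n ∸ k) C m)        ∎
    where open ≡-Reasoning
  ... | yes k≤n = begin
    (n C (k + m)) * ((k + m) C k)  ≡⟨ cong (_* ((k + m) C k)) (k>n⇒nCk≡0 (≰⇒> k+m≰n)) ⟩
    0                              ≡⟨ *-zeroʳ (n C k) ⟨
    (n C k) * 0                    ≡⟨ cong ((n C k) *_) (k>n⇒nCk≡0 n∸k<m) ⟨
    (n C k) * ((n ∸ k) C m)        ∎
    where
    open ≡-Reasoning
    n∸k<m : n ∸ k < m
    n∸k<m = +-cancelˡ-< k (n ∸ k) m (subst (_< k + m) (sym (m+[n∸m]≡n k≤n)) (≰⇒> k+m≰n))


module Laplace where

  open import Data.Integer using (ℤ; +_; -[1+_]; _*_; _-_; -_)
  open import Data.Integer.Properties using (*-zeroˡ; *-zeroʳ; *-identityˡ; *-identityʳ; *-assoc; +-identityʳ)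
  open import Data.Integer.Tactic.RingSolver using (solve-∀)
  open import Data.List using (List; []; _∷_; map; length; foldr)
  open import Data.List.Properties using (map-∘; map-cong; map-cong-local)
  open import Data.List.Relation.Unary.All as All using (All; []; _∷_)
  open import Data.List.Relation.Unary.All.Properties using (map⁺)
  open import Data.Nat using (ℕ; zero; suc)
  import Data.Nat.Properties as ℕ
  open import Data.Product using (_,_)
  open import Function using (_∘_)
  open import Relation.Binary.PropositionalEquality
  open import Defs using (picks; altSum; interval)

  -- A row is a function of the column index, and det fs cs is the minor of the rows fs on the
  -- columns cs, expanded along the first row as in bdet.
  Row : Set
  Row = ℕ → ℤ

  expand : Row → (List ℕ → ℤ) → List ℕ → ℤ
  expand f minor cs = altSum (map (λ (c , rest) → f c * minor rest) (picks cs))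

  det : List Row → List ℕ → ℤ
  det []       = λ _ → + 1
  det (f ∷ fs) = expand f (det fs)

  productℤ : List ℤ → ℤ
  productℤ = foldr _*_ (+ 1)

  private
    *-distribˡ-minus : ∀ a b c → a * (b - c) ≡ a * b - a * c
    *-distribˡ-minus = solve-∀
    *-distribʳ-minus : ∀ a b c → (a - b) * c ≡ a * c - b * c
    *-distribʳ-minus = solve-∀
    *-leftComm : ∀ a b c → a * (b * c) ≡ b * (a * c)
    *-leftComm = solve-∀

  module _ {A : Set} where

    altSum-map-zero : ∀ {h : A → ℤ} l → All (λ p → h p ≡ + 0) l → altSum (map h l) ≡ + 0
    altSum-map-zero []      []       = refl
    altSum-map-zero (_ ∷ l) (e ∷ es) rewrite e | altSum-map-zero l es = refl

    altSum-map-minus : ∀ (h₁ h₂ : A → ℤ) l →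
                       altSum (map (λ p → h₁ p - h₂ p) l) ≡ altSum (map h₁ l) - altSum (map h₂ l)
    altSum-map-minus h₁ h₂ []      = refl
    altSum-map-minus h₁ h₂ (p ∷ l) rewrite altSum-map-minus h₁ h₂ l =
      regroup (h₁ p) (h₂ p) (altSum (map h₁ l)) (altSum (map h₂ l))
      where
      regroup : ∀ a b c d → (a - b) - (c - d) ≡ (a - c) - (b - d)
      regroup = solve-∀

    altSum-map-scale : ∀ a (h : A → ℤ) l → altSum (map (λ p → a * h p) l) ≡ a * altSum (map h l)
    altSum-map-scale a h []      = sym (*-zeroʳ a)
    altSum-map-scale a h (p ∷ l) rewrite altSum-map-scale a h l = sym (*-distribˡ-minus a (h p) (altSum (map h l)))

  expand-∷ : ∀ f minor c cs → expand f minor (c ∷ cs) ≡ f c * minor cs - expand f (minor ∘ (c ∷_)) cs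
  expand-∷ f minor c cs = cong (λ z → f c * minor cs - z) (cong altSum (sym (map-∘ (picks cs))))

  expand-cong : ∀ {f g minor₁ minor₂} → f ≗ g → minor₁ ≗ minor₂ → expand f minor₁ ≗ expand g minor₂
  expand-cong f≗g m₁≗m₂ cs =
    cong altSum (map-cong (λ (c , rest) → cong₂ _*_ (f≗g c) (m₁≗m₂ rest)) (picks cs))

  expand-congʳ : ∀ f {minor₁ minor₂} → minor₁ ≗ minor₂ → expand f minor₁ ≗ expand f minor₂
  expand-congʳ f = expand-cong {f} (λ _ → refl)

  expand-minor-minus : ∀ f minor₁ minor₂ cs →
    expand f (λ ys → minor₁ ys - minor₂ ys) cs ≡ expand f minor₁ cs - expand f minor₂ cs
  expand-minor-minus f minor₁ minor₂ cs = trans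
    (cong altSum (map-cong (λ (c , rest) → *-distribˡ-minus (f c) (minor₁ rest) (minor₂ rest)) (picks cs)))
    (altSum-map-minus _ _ (picks cs))

  expand-minor-scale : ∀ f a minor cs → expand f (λ ys → a * minor ys) cs ≡ a * expand f minor cs
  expand-minor-scale f a minor cs = trans
    (cong altSum (map-cong (λ (c , rest) → *-leftComm (f c) a (minor rest)) (picks cs)))
    (altSum-map-scale a _ (picks cs))

  expand-row-minus : ∀ f g minor cs → expand (λ c → g c - f c) minor cs ≡ expand g minor cs - expand f minor cs
  expand-row-minus f g minor cs = trans
    (cong altSum (map-cong (λ (c , rest) → *-distribʳ-minus (g c) (f c) (minor rest)) (picks cs)))
    (altSum-map-minus _ _ (picks cs))

  expand-row-scale : ∀ a f minor cs → expand (λ c → a * f c) minor cs ≡ a * expand f minor cs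
  expand-row-scale a f minor cs = trans
    (cong altSum (map-cong (λ (c , rest) → *-assoc a (f c) (minor rest)) (picks cs)))
    (altSum-map-scale a _ (picks cs))

  expand²-∷ : ∀ f g minor c cs → expand f (expand g minor) (c ∷ cs)
            ≡ f c * expand g minor cs - (g c * expand f minor cs - expand f (expand g (minor ∘ (c ∷_))) cs)
  expand²-∷ f g minor c cs = begin
    expand f (expand g minor) (c ∷ cs)
      ≡⟨ expand-∷ f (expand g minor) c cs ⟩
    f c * expand g minor cs - expand f (λ ys → expand g minor (c ∷ ys)) cs
      ≡⟨ cong (λ z → f c * expand g minor cs - z) (expand-congʳ f (expand-∷ g minor c) cs) ⟩
    f c * expand g minor cs - expand f (λ ys → g c * minor ys - expand g (minor ∘ (c ∷_)) ys) cs
      ≡⟨ cong (λ z → f c * expand g minor cs - z) (expand-minor-minus f _ _ cs) ⟩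
    f c * expand g minor cs - (expand f (λ ys → g c * minor ys) cs - expand f (expand g (minor ∘ (c ∷_))) cs)
      ≡⟨ cong (λ z → f c * expand g minor cs - (z - expand f (expand g (minor ∘ (c ∷_))) cs))
              (expand-minor-scale f (g c) minor cs) ⟩
    f c * expand g minor cs - (g c * expand f minor cs - expand f (expand g (minor ∘ (c ∷_))) cs) ∎
    where open ≡-Reasoning

  expand-anticomm : ∀ f g minor cs → expand f (expand g minor) cs ≡ - expand g (expand f minor) cs
  expand-anticomm f g minor []       = refl
  expand-anticomm f g minor (c ∷ cs)
    rewrite expand²-∷ f g minor c cs | expand²-∷ g f minor c cs | expand-anticomm f g (minor ∘ (c ∷_)) cs =
    swap (f c) (expand g minor cs) (g c) (expand f minor cs) (expand g (expand f (minor ∘ (c ∷_))) cs)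
    where
    swap : ∀ a b c d e → a * b - (c * d - - e) ≡ - (c * d - (a * b - e))
    swap = solve-∀

  i≡-i⇒i≡0 : ∀ {i} → i ≡ - i → i ≡ + 0
  i≡-i⇒i≡0 {+ zero}   _  = refl
  i≡-i⇒i≡0 {+ suc _}  ()
  i≡-i⇒i≡0 { -[1+ _ ]} ()

  expand-alternating : ∀ f minor cs → expand f (expand f minor) cs ≡ + 0
  expand-alternating f minor cs = i≡-i⇒i≡0 (expand-anticomm f f minor cs)

  det-subtract-row : ∀ f g fs cs → det (f ∷ (λ c → g c - f c) ∷ fs) cs ≡ det (f ∷ g ∷ fs) cs
  det-subtract-row f g fs cs = begin
    expand f (expand (λ c → g c - f c) (det fs)) cs
      ≡⟨ expand-congʳ f (expand-row-minus f g (det fs)) cs ⟩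
    expand f (λ ys → expand g (det fs) ys - expand f (det fs) ys) cs
      ≡⟨ expand-minor-minus f _ _ cs ⟩
    expand f (expand g (det fs)) cs - expand f (expand f (det fs)) cs
      ≡⟨ cong (λ z → expand f (expand g (det fs)) cs - z) (expand-alternating f (det fs) cs) ⟩
    expand f (expand g (det fs)) cs - + 0
      ≡⟨ +-identityʳ _ ⟩
    expand f (expand g (det fs)) cs ∎
    where open ≡-Reasoning

  Δ : (ℕ → Row) → ℕ → Row
  Δ M t c = M (suc t) c - M t c

  det-differences : ∀ (M : ℕ → Row) s n cs →
    det (M s ∷ map (Δ M) (interval s n)) cs ≡ det (M s ∷ map M (interval (suc s) n)) cs
  det-differences M s zero    cs = refl
  det-differences M s (suc n) cs = trans
    (det-subtract-row (M s) (M (suc s)) (map (Δ M) (interval (suc s) n)) cs)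
    (expand-congʳ (M s) (det-differences M (suc s) n) cs)

  picks-length : ∀ {A : Set} (cs : List A) → All (λ (_ , rest) → suc (length rest) ≡ length cs) (picks cs)
  picks-length []       = []
  picks-length (c ∷ cs) = refl ∷ map⁺ (All.map (cong suc) (picks-length cs))

  picks-map : ∀ {A B : Set} (h : A → B) cs → picks (map h cs) ≡ map (λ (c , rest) → h c , map h rest) (picks cs)
  picks-map h []       = refl
  picks-map h (c ∷ cs) = cong ((h c , map h cs) ∷_) (begin
    map (λ (y , ys) → y , h c ∷ ys) (picks (map h cs))
      ≡⟨ cong (map _) (picks-map h cs) ⟩
    map (λ (y , ys) → y , h c ∷ ys) (map (λ (y , ys) → h y , map h ys) (picks cs))
      ≡⟨ map-∘ (picks cs) ⟨
    map (λ (y , ys) → h y , map h (c ∷ ys)) (picks cs)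
      ≡⟨ map-∘ (picks cs) ⟩
    map (λ (y , ys) → h y , map h ys) (map (λ (y , ys) → y , c ∷ ys) (picks cs)) ∎)
    where open ≡-Reasoning

  picks-product : ∀ {A : Set} (w : A → ℤ) cs →
    All (λ (c , rest) → productℤ (map w cs) ≡ w c * productℤ (map w rest)) (picks cs)
  picks-product w []       = []
  picks-product w (c ∷ cs) = refl ∷ map⁺ (All.map
    (λ {(c′ , rest)} e → trans (cong (w c *_) e) (*-leftComm (w c) (w c′) (productℤ (map w rest))))
    (picks-product w cs))

  mutual
    det-zero-column : ∀ fs c cs → All (λ f → f c ≡ + 0) fs → suc (length cs) ≡ length fs →
                      det fs (c ∷ cs) ≡ + 0
    det-zero-column (f ∷ fs) c cs (fc≡0 ∷ fs-c≡0) len = begin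
      expand f (det fs) (c ∷ cs) ≡⟨ expand-zero-column f fs c cs fs-c≡0 (ℕ.suc-injective len) ⟩
      f c * det fs cs            ≡⟨ cong (_* det fs cs) fc≡0 ⟩
      + 0 * det fs cs            ≡⟨ *-zeroˡ (det fs cs) ⟩
      + 0                        ∎
      where open ≡-Reasoning

    expand-zero-column : ∀ f fs c cs → All (λ g → g c ≡ + 0) fs → length cs ≡ length fs →
                         expand f (det fs) (c ∷ cs) ≡ f c * det fs cs
    expand-zero-column f fs c cs fs-c≡0 len = begin
      expand f (det fs) (c ∷ cs)                        ≡⟨ expand-∷ f (det fs) c cs ⟩
      f c * det fs cs - expand f (det fs ∘ (c ∷_)) cs   ≡⟨ cong (λ z → f c * det fs cs - z) minor-vanishes ⟩
      f c * det fs cs - + 0                             ≡⟨ +-identityʳ _ ⟩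
      f c * det fs cs                                   ∎
      where
      open ≡-Reasoning
      minor-vanishes : expand f (det fs ∘ (c ∷_)) cs ≡ + 0
      minor-vanishes = altSum-map-zero (picks cs) (All.map
        (λ {(c′ , rest)} len′ → trans (cong (f c′ *_) (det-zero-column fs c rest fs-c≡0 (trans len′ len)))
                                      (*-zeroʳ (f c′)))
        (picks-length cs))

  det-unit-column : ∀ f fs c cs → f c ≡ + 1 → All (λ g → g c ≡ + 0) fs → length cs ≡ length fs →
                    det (f ∷ fs) (c ∷ cs) ≡ det fs cs
  det-unit-column f fs c cs fc≡1 fs-c≡0 len =
    trans (expand-zero-column f fs c cs fs-c≡0 len) (trans (cong (_* det fs cs) fc≡1) (*-identityˡ (det fs cs)))

  module _ {A : Set} where

    det-map-columns : ∀ (R : A → Row) (h : ℕ → ℕ) xs cs →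
      det (map R xs) (map h cs) ≡ det (map (λ x → R x ∘ h) xs) cs
    det-map-columns R h []       cs = refl
    det-map-columns R h (x ∷ xs) cs = begin
      altSum (map (λ (c , rest) → R x c * det (map R xs) rest) (picks (map h cs)))
        ≡⟨ cong (λ ps → altSum (map _ ps)) (picks-map h cs) ⟩
      altSum (map (λ (c , rest) → R x c * det (map R xs) rest) (map (λ (c , rest) → h c , map h rest) (picks cs)))
        ≡⟨ cong altSum (map-∘ (picks cs)) ⟨
      expand (R x ∘ h) (det (map R xs) ∘ map h) cs
        ≡⟨ expand-congʳ (R x ∘ h) (det-map-columns R h xs) cs ⟩
      expand (R x ∘ h) (det (map (λ x → R x ∘ h) xs)) cs ∎
      where open ≡-Reasoning

    det-cong : ∀ {R R′ : A → Row} → (∀ x → R x ≗ R′ x) → ∀ xs → det (map R xs) ≗ det (map R′ xs)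
    det-cong R≗R′ []       cs = refl
    det-cong R≗R′ (x ∷ xs) cs = expand-cong (R≗R′ x) (det-cong R≗R′ xs) cs

    det-scale-rows : ∀ (a : A → ℤ) (R : A → Row) xs cs →
      det (map (λ x c → a x * R x c) xs) cs ≡ productℤ (map a xs) * det (map R xs) cs
    det-scale-rows a R []       cs = sym (*-identityʳ (+ 1))
    det-scale-rows a R (x ∷ xs) cs = begin
      expand (λ c → a x * R x c) (det (map (λ x c → a x * R x c) xs)) cs
        ≡⟨ expand-congʳ (λ c → a x * R x c) (det-scale-rows a R xs) cs ⟩
      expand (λ c → a x * R x c) (λ ys → productℤ (map a xs) * det (map R xs) ys) cs
        ≡⟨ expand-minor-scale (λ c → a x * R x c) (productℤ (map a xs)) (det (map R xs)) cs ⟩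
      productℤ (map a xs) * expand (λ c → a x * R x c) (det (map R xs)) cs
        ≡⟨ cong (productℤ (map a xs) *_) (expand-row-scale (a x) (R x) (det (map R xs)) cs) ⟩
      productℤ (map a xs) * (a x * expand (R x) (det (map R xs)) cs)
        ≡⟨ *-leftComm (productℤ (map a xs)) (a x) _ ⟩
      a x * (productℤ (map a xs) * expand (R x) (det (map R xs)) cs)
        ≡⟨ *-assoc (a x) (productℤ (map a xs)) _ ⟨
      productℤ (map a (x ∷ xs)) * det (map R (x ∷ xs)) cs ∎
      where open ≡-Reasoning

    det-scale-columns : ∀ (w : ℕ → ℤ) (R : A → Row) xs cs → length cs ≡ length xs →
      det (map (λ x c → R x c * w c) xs) cs ≡ productℤ (map w cs) * det (map R xs) cs
    det-scale-columns w R []       []      _   = refl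
    det-scale-columns w R (x ∷ xs) cs      len = trans
      (cong altSum (map-cong-local (All.zipWith (λ {(c , rest)} (len′ , prod) → begin
         (R x c * w c) * det (map (λ x c → R x c * w c) xs) rest
           ≡⟨ cong ((R x c * w c) *_) (det-scale-columns w R xs rest (ℕ.suc-injective (trans len′ len))) ⟩
         (R x c * w c) * (productℤ (map w rest) * det (map R xs) rest)
           ≡⟨ regroup (R x c) (w c) _ _ ⟩
         (w c * productℤ (map w rest)) * (R x c * det (map R xs) rest)
           ≡⟨ cong (_* (R x c * det (map R xs) rest)) prod ⟨
         productℤ (map w cs) * (R x c * det (map R xs) rest) ∎)
         (picks-length cs , picks-product w cs))))
      (altSum-map-scale (productℤ (map w cs)) (λ (c , rest) → R x c * det (map R xs) rest) (picks cs))
      where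
      open ≡-Reasoning
      regroup : ∀ a b c d → (a * b) * (c * d) ≡ (b * c) * (a * d)
      regroup = solve-∀

module IndexArithmetic where

  open import Data.Nat
  open import Data.Nat.Properties
  open import Data.List using (_∷_; map; length)
  open import Data.List.Properties using (map-cong; map-∘)
  open import Relation.Binary.PropositionalEquality
  open import Defs using (interval)

  length-interval : ∀ a n → length (interval a n) ≡ n
  length-interval a zero    = refl
  length-interval a (suc n) = cong suc (length-interval (suc a) n)

  map-interval : ∀ (f : ℕ → ℕ) a n → (∀ t → a ≤ t → f (suc t) ≡ suc (f t)) →
                 map f (interval a n) ≡ interval (f a) n
  map-interval f a zero    _       = refl
  map-interval f a (suc n) f-shift = cong (f a ∷_) (begin
    map f (interval (suc a) n)  ≡⟨ map-interval f (suc a) n (λ t a<t → f-shift t (<⇒≤ a<t)) ⟩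
    interval (f (suc a)) n      ≡⟨ cong (λ s → interval s n) (f-shift a ≤-refl) ⟩
    interval (suc (f a)) n      ∎)
    where open ≡-Reasoning

  map-∸-interval : ∀ {j i} n → j ≤ i → map (_∸ j) (interval i n) ≡ interval (i ∸ j) n
  map-∸-interval {j} {i} n j≤i = map-interval (_∸ j) i n (λ t i≤t → +-∸-assoc 1 (≤-trans j≤i i≤t))

  [m∸o]∸[n∸o]≡m∸n : ∀ m n o → o ≤ n → (m ∸ o) ∸ (n ∸ o) ≡ m ∸ n
  [m∸o]∸[n∸o]≡m∸n m       n       zero    _         = refl
  [m∸o]∸[n∸o]≡m∸n zero    (suc n) (suc o) _         = 0∸n≡0 (n ∸ o)
  [m∸o]∸[n∸o]≡m∸n (suc m) (suc n) (suc o) (s≤s o≤n) = [m∸o]∸[n∸o]≡m∸n m n o o≤n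

  -- J^{(1)} = map (lower j₁) (j₂ ∷ … ∷ j_d).
  lower : ℕ → ℕ → ℕ
  lower j t = t ∸ j ∸ 1

  lower≡∸suc : ∀ j t → lower j t ≡ t ∸ suc j
  lower≡∸suc j t = trans (∸-+-assoc t j 1) (cong (t ∸_) (+-comm j 1))

  lower-suc : ∀ j a → lower j (suc a) ≡ a ∸ j
  lower-suc j a = lower≡∸suc j (suc a)

  suc-lower : ∀ {j t} → j < t → suc (lower j t) ≡ t ∸ j
  suc-lower {j} {t} j<t = trans (cong suc (lower≡∸suc j t)) (sym (+-∸-assoc 1 j<t))

  lower-mono-≤ : ∀ j {x y} → x ≤ y → lower j x ≤ lower j y
  lower-mono-≤ j x≤y = ∸-monoˡ-≤ 1 (∸-monoˡ-≤ j x≤y)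

  lower-mono-< : ∀ {j x y} → j < x → x < y → lower j x < lower j y
  lower-mono-< {j} {x} {y} j<x x<y =
    subst₂ _<_ (sym (lower≡∸suc j x)) (sym (lower≡∸suc j y)) (∸-monoˡ-< x<y j<x)

  lower-∸-lower : ∀ {j x} t → j < x → lower j t ∸ lower j x ≡ t ∸ x
  lower-∸-lower {j} {x} t j<x = begin
    lower j t ∸ lower j x        ≡⟨ cong₂ _∸_ (lower≡∸suc j t) (lower≡∸suc j x) ⟩
    (t ∸ suc j) ∸ (x ∸ suc j)    ≡⟨ [m∸o]∸[n∸o]≡m∸n t x (suc j) j<x ⟩
    t ∸ x                        ∎
    where open ≡-Reasoning

  map-lower-interval : ∀ {j a} n → j ≤ a → map (lower j) (interval (suc a) n) ≡ interval (a ∸ j) n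
  map-lower-interval {j} {a} n j≤a = trans
    (map-interval (lower j) (suc a) n (λ t a<t → trans (lower-suc j t) (sym (suc-lower (≤-<-trans j≤a a<t)))))
    (cong (λ s → interval s n) (lower-suc j a))

  map-∸-interval-lower : ∀ {j a x} n → j ≤ a → j < x →
                         map (_∸ x) (interval (suc a) n) ≡ map (_∸ lower j x) (interval (a ∸ j) n)
  map-∸-interval-lower {j} {a} {x} n j≤a j<x = begin
    map (_∸ x) (interval (suc a) n)
      ≡⟨ map-cong (λ t → lower-∸-lower t j<x) (interval (suc a) n) ⟨
    map (λ t → lower j t ∸ lower j x) (interval (suc a) n)
      ≡⟨ map-∘ (interval (suc a) n) ⟩
    map (_∸ lower j x) (map (lower j) (interval (suc a) n))
      ≡⟨ cong (map (_∸ lower j x)) (map-lower-interval n j≤a) ⟩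
    map (_∸ lower j x) (interval (a ∸ j) n) ∎
    where open ≡-Reasoning

module BinomialMinors where

  open import Data.Integer as ℤ using (ℤ; +_)
  import Data.Integer.Properties as ℤ
  open import Data.Integer.Tactic.RingSolver using (solve-∀)
  open import Data.Nat as ℕ using (ℕ; suc; _+_; _∸_; _≤_; _<_)
  import Data.Nat.Properties as ℕ
  open import Data.Nat.Combinatorics using (nCk+nC[k+1]≡[n+1]C[k+1])
  open import Data.List using ([]; _∷_; map; length)
  open import Data.List.Properties using (map-∘; map-cong; map-cong-local; map-id-local; length-map)
  open import Data.List.Relation.Unary.All as All using (All; []; _∷_)
  open import Data.List.Relation.Unary.All.Properties using (map⁺)
  open import Data.Product using (_,_)
  open import Function using (_∘_)
  open import Relation.Binary.PropositionalEquality
  open import Defs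
  open Laplace
  open Binomial
  open IndexArithmetic

  binomialRow : ℕ → Row
  binomialRow r c = + b r c

  bdet-det : ∀ rs cs → bdet rs cs ≡ det (map binomialRow rs) cs
  bdet-det []       cs = refl
  bdet-det (r ∷ rs) cs =
    cong altSum (map-cong (λ (c , rest) → cong (binomialRow r c ℤ.*_) (bdet-det rs rest)) (picks cs))

  +-prodℕ : ∀ {A : Set} (f : A → ℕ) xs → + prodℕ (map f xs) ≡ productℤ (map (+_ ∘ f) xs)
  +-prodℕ f []       = refl
  +-prodℕ f (x ∷ xs) = trans (ℤ.pos-* (f x) (prodℕ (map f xs))) (cong (+ f x ℤ.*_) (+-prodℕ f xs))

  Δ-binomialRow : ∀ t c → Δ binomialRow t (suc c) ≡ binomialRow t c
  Δ-binomialRow t c = begin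
    + b (suc t) (suc c) ℤ.- + b t (suc c)
      ≡⟨ cong (λ z → + z ℤ.- + b t (suc c)) (nCk+nC[k+1]≡[n+1]C[k+1] t c) ⟨
    + (b t c ℕ.+ b t (suc c)) ℤ.- + b t (suc c)
      ≡⟨ cong (ℤ._- + b t (suc c)) (ℤ.pos-+ (b t c) (b t (suc c))) ⟩
    + b t c ℤ.+ + b t (suc c) ℤ.- + b t (suc c)
      ≡⟨ cancel (+ b t c) (+ b t (suc c)) ⟩
    + b t c ∎
    where
    open ≡-Reasoning
    cancel : ∀ x y → x ℤ.+ y ℤ.- y ≡ x
    cancel = solve-∀

  bdet-pascal : ∀ a n cs → length cs ≡ n → bdet (interval a (suc n)) (0 ∷ map suc cs) ≡ bdet (interval a n) cs
  bdet-pascal a n cs len = begin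
    bdet (interval a (suc n)) (0 ∷ map suc cs)
      ≡⟨ bdet-det (interval a (suc n)) (0 ∷ map suc cs) ⟩
    det (binomialRow a ∷ map binomialRow (interval (suc a) n)) (0 ∷ map suc cs)
      ≡⟨ det-differences binomialRow a n (0 ∷ map suc cs) ⟨
    det (binomialRow a ∷ map (Δ binomialRow) (interval a n)) (0 ∷ map suc cs)
      ≡⟨ det-unit-column (binomialRow a) (map (Δ binomialRow) (interval a n)) 0 (map suc cs)
                         refl first-column-zero lengths-agree ⟩
    det (map (Δ binomialRow) (interval a n)) (map suc cs)
      ≡⟨ det-map-columns (Δ binomialRow) suc (interval a n) cs ⟩
    det (map (λ t → Δ binomialRow t ∘ suc) (interval a n)) cs
      ≡⟨ det-cong Δ-binomialRow (interval a n) cs ⟩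
    det (map binomialRow (interval a n)) cs
      ≡⟨ bdet-det (interval a n) cs ⟨
    bdet (interval a n) cs ∎
    where
    open ≡-Reasoning
    first-column-zero : All (λ f → f 0 ≡ + 0) (map (Δ binomialRow) (interval a n))
    first-column-zero = map⁺ (All.universal (λ _ → refl) (interval a n))
    lengths-agree : length (map suc cs) ≡ length (map (Δ binomialRow) (interval a n))
    lengths-agree = begin
      length (map suc cs)                             ≡⟨ length-map suc cs ⟩
      length cs                                       ≡⟨ len ⟩
      n                                               ≡⟨ length-interval a n ⟨
      length (interval a n)                           ≡⟨ length-map (Δ binomialRow) (interval a n) ⟨
      length (map (Δ binomialRow) (interval a n))     ∎

  binomialRow-trinomial : ∀ r j c → binomialRow r (j + c) ℤ.* + b (j + c) j ≡ + b r j ℤ.* binomialRow (r ∸ j) c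
  binomialRow-trinomial r j c = begin
    + b r (j + c) ℤ.* + b (j + c) j    ≡⟨ ℤ.pos-* (b r (j + c)) (b (j + c) j) ⟨
    + (b r (j + c) ℕ.* b (j + c) j)    ≡⟨ cong +_ (nC[k+m]*[k+m]Ck≡nCk*[n∸k]Cm r j c) ⟩
    + (b r j ℕ.* b (r ∸ j) c)          ≡⟨ ℤ.pos-* (b r j) (b (r ∸ j) c) ⟩
    + b r j ℤ.* + b (r ∸ j) c          ∎
    where open ≡-Reasoning

  bdet-factor : ∀ j I J → All (j ≤_) J → length J ≡ length I →
    + prodℕ (map (λ y → b y j) J) ℤ.* bdet I J
    ≡ + prodℕ (map (λ r → b r j) I) ℤ.* bdet (map (_∸ j) I) (map (_∸ j) J)
  bdet-factor j I J j≤J len = begin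
    + prodℕ (map (λ y → b y j) J) ℤ.* bdet I J
      ≡⟨ cong₂ ℤ._*_ column-factors (bdet-det I J) ⟩
    productℤ (map w cs) ℤ.* det (map binomialRow I) J
      ≡⟨ cong (λ K → productℤ (map w cs) ℤ.* det (map binomialRow I) K) J≡j+cs ⟨
    productℤ (map w cs) ℤ.* det (map binomialRow I) (map (λ c → j + c) cs)
      ≡⟨ cong (productℤ (map w cs) ℤ.*_) (det-map-columns binomialRow (λ c → j + c) I cs) ⟩
    productℤ (map w cs) ℤ.* det (map (λ r c → binomialRow r (j + c)) I) cs
      ≡⟨ det-scale-columns w (λ r c → binomialRow r (j + c)) I cs length-cs ⟨
    det (map (λ r c → binomialRow r (j + c) ℤ.* w c) I) cs
      ≡⟨ det-cong (λ r c → binomialRow-trinomial r j c) I cs ⟩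
    det (map (λ r c → + b r j ℤ.* binomialRow (r ∸ j) c) I) cs
      ≡⟨ det-scale-rows (λ r → + b r j) (λ r → binomialRow (r ∸ j)) I cs ⟩
    productℤ (map (λ r → + b r j) I) ℤ.* det (map (λ r → binomialRow (r ∸ j)) I) cs
      ≡⟨ cong₂ ℤ._*_ (+-prodℕ (λ r → b r j) I) (cong (λ R → det R cs) (sym (map-∘ I))) ⟨
    + prodℕ (map (λ r → b r j) I) ℤ.* det (map binomialRow (map (_∸ j) I)) cs
      ≡⟨ cong (+ prodℕ (map (λ r → b r j) I) ℤ.*_) (bdet-det (map (_∸ j) I) cs) ⟨
    + prodℕ (map (λ r → b r j) I) ℤ.* bdet (map (_∸ j) I) cs ∎
    where
    open ≡-Reasoning
    cs = map (_∸ j) J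
    w : ℕ → ℤ
    w c = + b (j + c) j
    J≡j+cs : map (λ c → j + c) cs ≡ J
    J≡j+cs = trans (sym (map-∘ J)) (map-id-local (All.map ℕ.m+[n∸m]≡n j≤J))
    column-factors : + prodℕ (map (λ y → b y j) J) ≡ productℤ (map w cs)
    column-factors = begin
      + prodℕ (map (λ y → b y j) J)
        ≡⟨ +-prodℕ (λ y → b y j) J ⟩
      productℤ (map (λ y → + b y j) J)
        ≡⟨ cong (λ K → productℤ (map (λ y → + b y j) K)) J≡j+cs ⟨
      productℤ (map (λ y → + b y j) (map (λ c → j + c) cs))
        ≡⟨ cong productℤ (map-∘ cs) ⟨
      productℤ (map w cs) ∎
    length-cs : length cs ≡ length I
    length-cs = trans (length-map (_∸ j) J) len

  bdet-peel : ∀ i j rest n → j ≤ i → All (j <_) rest → length rest ≡ n →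
    + prodℕ (map (λ y → b y j) (j ∷ rest)) ℤ.* bdet (interval i (suc n)) (j ∷ rest)
    ≡ + prodℕ (map (λ r → b r j) (interval i (suc n))) ℤ.* bdet (interval (i ∸ j) n) (map (lower j) rest)
  bdet-peel i j rest n j≤i j<rest len = begin
    + prodℕ (map (λ y → b y j) (j ∷ rest)) ℤ.* bdet (interval i (suc n)) (j ∷ rest)
      ≡⟨ bdet-factor j (interval i (suc n)) (j ∷ rest) (ℕ.≤-refl ∷ All.map ℕ.<⇒≤ j<rest) lengths-agree ⟩
    row-factors ℤ.* bdet (map (_∸ j) (interval i (suc n))) (map (_∸ j) (j ∷ rest))
      ≡⟨ cong₂ (λ I J → row-factors ℤ.* bdet I J) (map-∸-interval (suc n) j≤i) columns ⟩
    row-factors ℤ.* bdet (interval (i ∸ j) (suc n)) (0 ∷ map suc (map (lower j) rest))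
      ≡⟨ cong (row-factors ℤ.*_) (bdet-pascal (i ∸ j) n (map (lower j) rest) length-lowered) ⟩
    row-factors ℤ.* bdet (interval (i ∸ j) n) (map (lower j) rest) ∎
    where
    open ≡-Reasoning
    row-factors = + prodℕ (map (λ r → b r j) (interval i (suc n)))
    lengths-agree : length (j ∷ rest) ≡ length (interval i (suc n))
    lengths-agree = cong suc (trans len (sym (length-interval (suc i) n)))
    length-lowered : length (map (lower j) rest) ≡ n
    length-lowered = trans (length-map (lower j) rest) len
    columns : map (_∸ j) (j ∷ rest) ≡ 0 ∷ map suc (map (lower j) rest)
    columns = cong₂ _∷_ (ℕ.n∸n≡0 j) (trans (map-cong-local (All.map (sym ∘ suc-lower) j<rest)) (map-∘ rest))

module RationalFactor where

  open import Data.Integer as ℤ using (+_)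
  import Data.Integer.Properties as ℤ
  open import Data.Nat as ℕ using (suc; _<_)
  import Data.Nat.Properties as ℕ
  open import Data.Rational using (_*_; toℚᵘ)
  import Data.Rational.Properties as ℚ
  open import Data.Rational.Unnormalised as ℚᵘ using (mkℚᵘ; *≡*)
  import Data.Rational.Unnormalised.Properties as ℚᵘ
  open import Relation.Binary.PropositionalEquality
  open import Defs using (toℚ; frac)

  toℚ-frac : ∀ {m} n x y → 0 < m → + m ℤ.* x ≡ + n ℤ.* y → toℚ x ≡ frac n m * toℚ y
  toℚ-frac {suc m} n x y _ mx≡ny = ℚ.toℚᵘ-injective (begin
    toℚᵘ (toℚ x)                             ≈⟨ ℚ.toℚᵘ-fromℚᵘ (mkℚᵘ x 0) ⟩
    mkℚᵘ x 0                                 ≈⟨ *≡* cross-multiplied ⟩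
    mkℚᵘ (+ n) m ℚᵘ.* mkℚᵘ y 0               ≈⟨ ℚᵘ.*-cong (ℚ.toℚᵘ-fromℚᵘ (mkℚᵘ (+ n) m))
                                                             (ℚ.toℚᵘ-fromℚᵘ (mkℚᵘ y 0)) ⟨
    toℚᵘ (frac n (suc m)) ℚᵘ.* toℚᵘ (toℚ y)  ≈⟨ ℚ.toℚᵘ-homo-* (frac n (suc m)) (toℚ y) ⟨
    toℚᵘ (frac n (suc m) * toℚ y)            ∎)
    where
    open ℚᵘ.≃-Reasoning
    cross-multiplied : x ℤ.* + suc (m ℕ.* 1) ≡ + n ℤ.* y ℤ.* + 1
    cross-multiplied = trans (cong (λ k → x ℤ.* + suc k) (ℕ.*-identityʳ m))
      (trans (ℤ.*-comm x (+ suc m)) (trans mx≡ny (sym (ℤ.*-identityʳ (+ n ℤ.* y)))))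


open import Data.List using (List; []; _∷_; map; length; upTo; applyUpTo)
open import Data.List.Properties using (map-∘; map-cong; map-upTo)
open import Data.List.Relation.Unary.All as All using (All; []; _∷_)
open import Data.List.Relation.Unary.Linked as Linked using (Linked; []; [-]; _∷_)
open import Data.List.Relation.Unary.Linked.Properties using (Linked⇒All)
open import Data.List.Relation.Binary.Pointwise as Pointwise using (Pointwise; []; _∷_)
open import Data.List.Relation.Binary.Pointwise.Properties using (Pointwise-length)
open import Data.Nat using (ℕ; zero; suc; _+_; _∸_; _≤_; _<_; _<?_; z≤n; s≤s)
import Data.Nat.Properties as ℕ
open import Data.Product using (_×_; _,_)
open import Data.Rational using (ℚ; _*_)
import Data.Rational.Properties as ℚ
open import Function using (_∘_)
open import Relation.Binary.PropositionalEquality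
open import Relation.Nullary using (yes; no)
open import Defs
open Binomial using (0<nCk)
open IndexArithmetic
open BinomialMinors using (bdet-peel)
open RationalFactor using (toℚ-frac)

0<prodℕ-binomial : ∀ {j} ys → All (j ≤_) ys → 0 < prodℕ (map (λ y → b y j) ys)
0<prodℕ-binomial []       []          = s≤s z≤n
0<prodℕ-binomial (y ∷ ys) (j≤y ∷ j≤ys) = ℕ.*-mono-< (0<nCk j≤y) (0<prodℕ-binomial ys j≤ys)

bdet-peel-π : ∀ i j rest n → j ≤ i → All (j <_) rest → length rest ≡ n →
  toℚ (bdet (interval i (suc n)) (j ∷ rest))
  ≡ piIJ (interval i (suc n)) (j ∷ rest) * toℚ (bdet (interval (i ∸ j) n) (map (lower j) rest))
bdet-peel-π i j rest n j≤i j<rest len = toℚ-frac _ _ _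
  (0<prodℕ-binomial (j ∷ rest) (ℕ.≤-refl ∷ All.map ℕ.<⇒≤ j<rest))
  (bdet-peel i j rest n j≤i j<rest len)

nth-map : ∀ (g : ℕ → ℕ) → g 0 ≡ 0 → ∀ xs m → nth (map g xs) m ≡ g (nth xs m)
nth-map g g0≡0 []       m       = sym g0≡0
nth-map g g0≡0 (x ∷ xs) zero    = refl
nth-map g g0≡0 (x ∷ xs) (suc m) = nth-map g g0≡0 xs m

All-nth : ∀ {P : ℕ → Set} {xs} m → All P xs → m < length xs → P (nth xs m)
All-nth zero    (px ∷ _)   _         = px
All-nth (suc m) (_  ∷ pxs) (s≤s m<n) = All-nth m pxs m<n

Jₗ-lower : ∀ {j} xs m → All (j <_) xs → Jₗ xs (suc m) ≡ Jₗ (map (lower j) xs) (suc m)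
Jₗ-lower []       m       _           = refl
Jₗ-lower (x ∷ xs) zero    (j<x ∷ _)   =
  trans (map-cong (λ t → cong (_∸ 1) (sym (lower-∸-lower t j<x))) xs) (map-∘ xs)
Jₗ-lower (x ∷ xs) (suc m) (_ ∷ j<xs) = Jₗ-lower xs m j<xs

Iₗ-last : ∀ i d J → Iₗ i d J d ≡ []
Iₗ-last i zero    J = refl
Iₗ-last i (suc d) J = cong (λ n → map (λ t → t ∸ nth J d) (interval (i + d) n)) (ℕ.n∸n≡0 d)

module Peeled {i j : ℕ} {rest : List ℕ} {d : ℕ}
              (j≤i : j ≤ i) (j<rest : All (j <_) rest) (len : length rest ≡ d) where

  J′ : List ℕ
  J′ = map (lower j) rest

  Jₗ-peel : ∀ ℓ → Jₗ (j ∷ rest) (suc ℓ) ≡ Jₗ J′ ℓ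
  Jₗ-peel zero    = refl
  Jₗ-peel (suc m) = Jₗ-lower rest m j<rest

  Iₗ-peel : ∀ ℓ → Iₗ i (suc d) (j ∷ rest) (suc ℓ) ≡ Iₗ (i ∸ j) d J′ ℓ
  Iₗ-peel zero = trans (cong (λ a → map (_∸ j) (interval a d)) (ℕ.+-identityʳ i)) (map-∸-interval d j≤i)
  Iₗ-peel (suc m) with m <? d
  ... | no m≮d rewrite ℕ.m≤n⇒m∸n≡0 (ℕ.m≤n⇒m≤1+n (ℕ.≮⇒≥ m≮d)) = refl
  ... | yes m<d = begin
    map (_∸ x) (interval (i + suc m) n)
      ≡⟨ cong (λ a → map (_∸ x) (interval a n)) (ℕ.+-suc i m) ⟩
    map (_∸ x) (interval (suc (i + m)) n)
      ≡⟨ map-∸-interval-lower n (ℕ.≤-trans j≤i (ℕ.m≤m+n i m)) j<x ⟩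
    map (_∸ lower j x) (interval (i + m ∸ j) n)
      ≡⟨ cong₂ (λ y a → map (_∸ y) (interval a n)) nth-J′ (ℕ.+-∸-comm m j≤i) ⟩
    map (_∸ nth J′ m) (interval (i ∸ j + m) n) ∎
    where
    open ≡-Reasoning
    x = nth rest m
    n = d ∸ suc m
    j<x : j < x
    j<x = All-nth m j<rest (subst (m <_) (sym len) m<d)
    nth-J′ : lower j x ≡ nth J′ m
    nth-J′ = sym (nth-map (lower j) (cong (_∸ 1) (ℕ.0∸n≡0 j)) rest m)

  prodπ-peel : ∀ k →
    prodπ i (suc d) (j ∷ rest) (suc k) ≡ piIJ (interval i (suc d)) (j ∷ rest) * prodπ (i ∸ j) d J′ k
  prodπ-peel k = cong (λ πs → π 0 * prodℚ πs) (begin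
    map π (applyUpTo suc k)   ≡⟨ cong (map π) (map-upTo suc k) ⟨
    map π (map suc (upTo k))  ≡⟨ map-∘ (upTo k) ⟨
    map (π ∘ suc) (upTo k)    ≡⟨ map-cong (λ ℓ → cong₂ piIJ (Iₗ-peel ℓ) (Jₗ-peel ℓ)) (upTo k) ⟩
    map π′ (upTo k)           ∎)
    where
    open ≡-Reasoning
    π π′ : ℕ → ℚ
    π ℓ = piIJ (Iₗ i (suc d) (j ∷ rest) ℓ) (Jₗ (j ∷ rest) ℓ)
    π′ ℓ = piIJ (Iₗ (i ∸ j) d J′ ℓ) (Jₗ J′ ℓ)

  J′-linked : Linked _<_ rest → Linked _<_ J′
  J′-linked = go j<rest
    where
    go : ∀ {xs} → All (j <_) xs → Linked _<_ xs → Linked _<_ (map (lower j) xs)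
    go _                   []         = []
    go _                   [-]        = [-]
    go (j<x ∷ j<y ∷ j<xs) (x<y ∷ lk) = lower-mono-< j<x x<y ∷ go (j<y ∷ j<xs) lk

  J′-below : Pointwise _≤_ rest (interval (suc i) d) → Pointwise _≤_ J′ (interval (i ∸ j) d)
  J′-below rest≤ = subst (Pointwise _≤_ J′) (map-lower-interval d j≤i)
    (Pointwise.map⁺ (lower j) (lower j) (Pointwise.map (lower-mono-≤ j) rest≤))

head<tail : ∀ {j xs} → Linked _<_ (j ∷ xs) → All (j <_) xs
head<tail [-]       = []
head<tail (j<x ∷ x↑) = Linked⇒All ℕ.<-trans j<x x↑

bdet-factorisation : ∀ d i J → Linked _<_ J → Pointwise _≤_ J (interval i d) → ∀ k → k ≤ d →
  toℚ (bdet (interval i d) J) ≡ prodπ i d J k * toℚ (bdet (Iₗ i d J k) (Jₗ J k))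
bdet-factorisation d       i J          _  _              zero    _         = sym (ℚ.*-identityˡ _)
bdet-factorisation (suc d) i (j ∷ rest) J↑ (j≤i ∷ rest≤) (suc k) (s≤s k≤d) = begin
  toℚ (bdet (interval i (suc d)) (j ∷ rest))
    ≡⟨ bdet-peel-π i j rest d j≤i j<rest len ⟩
  π₀ * toℚ (bdet (interval (i ∸ j) d) J′)
    ≡⟨ cong (π₀ *_) (bdet-factorisation d (i ∸ j) J′ J′↑ (J′-below rest≤) k k≤d) ⟩
  π₀ * (prodπ (i ∸ j) d J′ k * toℚ (bdet (Iₗ (i ∸ j) d J′ k) (Jₗ J′ k)))
    ≡⟨ ℚ.*-assoc π₀ _ _ ⟨
  π₀ * prodπ (i ∸ j) d J′ k * toℚ (bdet (Iₗ (i ∸ j) d J′ k) (Jₗ J′ k))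
    ≡⟨ cong₂ (λ p (I , K) → p * toℚ (bdet I K)) (prodπ-peel k) (cong₂ _,_ (Iₗ-peel k) (Jₗ-peel k)) ⟨
  prodπ i (suc d) (j ∷ rest) (suc k) * toℚ (bdet (Iₗ i (suc d) (j ∷ rest) (suc k)) (Jₗ (j ∷ rest) (suc k))) ∎
  where
  open ≡-Reasoning
  j<rest = head<tail J↑
  len : length rest ≡ d
  len = trans (Pointwise-length rest≤) (length-interval (suc i) d)
  open Peeled j≤i j<rest len
  J′↑ = J′-linked (Linked.tail J↑)
  π₀ = piIJ (interval i (suc d)) (j ∷ rest)

theorem4p4 : (d i : ℕ) → 1 ≤ d → (J : List ℕ) → length J ≡ d → Linked _<_ J
    → Pointwise _≤_ J (interval i d)
    → ((k : ℕ) → 1 ≤ k → k ≤ d ∸ 1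
         → toℚ (bdet (interval i d) J) ≡ prodπ i d J k * toℚ (bdet (Iₗ i d J k) (Jₗ J k)))
      × (toℚ (bdet (interval i d) J) ≡ prodπ i d J d)
-- The factorisation holds for every k ≤ d.
theorem4p4 d i _ J _ J↑ J≤ =
  (λ k _ k≤d∸1 → bdet-factorisation d i J J↑ J≤ k (ℕ.≤-trans k≤d∸1 (ℕ.m∸n≤m d 1))) ,
  (begin
    toℚ (bdet (interval i d) J)
      ≡⟨ bdet-factorisation d i J J↑ J≤ d ℕ.≤-refl ⟩
    prodπ i d J d * toℚ (bdet (Iₗ i d J d) (Jₗ J d))
      ≡⟨ cong (λ I → prodπ i d J d * toℚ (bdet I (Jₗ J d))) (Iₗ-last i d J) ⟩
    prodπ i d J d * toℚ (bdet [] (Jₗ J d))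
      ≡⟨ ℚ.*-identityʳ (prodπ i d J d) ⟩
    prodπ i d J d ∎)
  where open ≡-Reasoning
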